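{- Let $p$ be a prime, $r\geq 2$ an integer, and $n\in\mathbb{N}$. Write $Z_p(n)=\alpha r+\beta$ with integers $\alpha\geq 0$ and $0\leq\beta<r$. Then $Z_{p^r}(n+1)=Z_{p^r}(n)$ if and only if $n+1=p^ma$ with $\gcd(p,a)=1$ and $0\leq m<r-\beta$.
   Context: For an integer $b\geq 2$, $Z_b(m)$ denotes the number of trailing zeroes in the base $b$ expansion of $m!$. Thus $Z_p(m)$ is the exponent of $p$ in $m!$, and $Z_{p^r}(m)=\lfloor Z_p(m)/r\rfloor$. -}

module Defs where

open import Data.Nat using (ℕ; suc; _^_; _!)
open import Data.Nat.Divisibility using (_∣_)
open import Data.Product using (_×_)
open import Relation.Nullary using (¬_)

-- TrailingZeros b m z : z is the number of trailing zeroes of the base-b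
-- expansion of m!, i.e. b^z divides m! but b^(z+1) does not.
-- (m! ≥ 1, so for b ≥ 2 such z exists and is unique.)
TrailingZeros : ℕ → ℕ → ℕ → Set
TrailingZeros b m z = (b ^ z ∣ m !) × ¬ (b ^ suc z ∣ m !)

{-# OPTIONS --safe #-}
-- Write v(x) for the exponent of p in x.  Since (p ^ r) ^ z = p ^ (z * r), the number of trailing
-- zeroes of m! in base p ^ r is ⌊v(m!) / r⌋, and v((n+1)!) = v(n+1) + v(n!).  With v(n!) = αr + β
-- and v(n+1) = m, the quotient ⌊(αr + β + m) / r⌋ stays equal to α exactly when m + β < r.
module Submission where

open import Defs
open import Data.Nat using (ℕ; suc; _+_; _*_; _∸_; _^_; _<_; _≤_; _!; NonZero; NonTrivial; nonTrivial⇒≢1)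
open import Data.Nat.Properties
open import Data.Nat.Divisibility
open import Data.Nat.Induction using (<-rec)
open import Data.Nat.Primality using (Prime; prime⇒nonZero; prime⇒nonTrivial; prime⇒irreducible; euclidsLemma)
open import Data.Nat.Coprimality using (Coprime; coprime⇒gcd≡1; gcd≡1⇒coprime)
open import Data.Nat.GCD using (gcd)
open import Data.Nat.Tactic.RingSolver using (solve-∀)
open import Data.Product using (_×_; ∃-syntax; _,_; uncurry)
open import Data.Sum using (inj₁; inj₂; [_,_]′)
open import Relation.Nullary using (¬_; yes; no; contradiction)
open import Relation.Binary.PropositionalEquality
open import Relation.Binary using (tri<; tri≈; tri>)
open import Function.Bundles using (_⇔_; mk⇔; Equivalence)
import Function.Properties.Equivalence as ⇔

record Valuation (p x e : ℕ) : Set where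
  constructor valuation
  field
    cofactor : ℕ
    factorisation : x ≡ p ^ e * cofactor
    p∤cofactor : ¬ p ∣ cofactor

_≡⌊_/_⌋ : ℕ → ℕ → ℕ → Set
z ≡⌊ e / r ⌋ = z * r ≤ e × e < suc z * r

≡⌊⌋-unique : ∀ {r e z z′} → z ≡⌊ e / r ⌋ → z′ ≡⌊ e / r ⌋ → z ≡ z′
≡⌊⌋-unique {r} {e} {z} {z′} (zr≤e , e<[1+z]r) (z′r≤e , e<[1+z′]r) with <-cmp z z′
... | tri≈ _ z≡z′ _ = z≡z′
... | tri< z<z′ _ _ = contradiction (≤-trans (*-monoˡ-≤ r z<z′) z′r≤e) (<⇒≱ e<[1+z]r)
... | tri> _ _ z>z′ = contradiction (≤-trans (*-monoˡ-≤ r z>z′) zr≤e) (<⇒≱ e<[1+z′]r)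

≡⌊⌋⇒[≡⇔≡⌊⌋] : ∀ {r e z q} → z ≡⌊ e / r ⌋ → z ≡ q ⇔ q ≡⌊ e / r ⌋
≡⌊⌋⇒[≡⇔≡⌊⌋] z⌊⌋ = mk⇔ (λ { refl → z⌊⌋ }) (≡⌊⌋-unique z⌊⌋)

≡⌊q*r+k/r⌋⇔k<r : ∀ r q k → q ≡⌊ q * r + k / r ⌋ ⇔ k < r
≡⌊q*r+k/r⌋⇔k<r r q k = mk⇔
  (λ (_ , upper) → +-cancelˡ-< (q * r) k r (subst (q * r + k <_) (+-comm r (q * r)) upper))
  (λ k<r → m≤m+n (q * r) k , subst (q * r + k <_) (+-comm (q * r) r) (+-monoʳ-< (q * r) k<r))

m≤n⇒o^m∣o^n : ∀ o {m n} → m ≤ n → o ^ m ∣ o ^ n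
m≤n⇒o^m∣o^n o {m} {n} m≤n = divides (o ^ (n ∸ m)) (begin
  o ^ n             ≡⟨ cong (o ^_) (sym (m+[n∸m]≡n m≤n)) ⟩
  o ^ (m + (n ∸ m)) ≡⟨ ^-distribˡ-+-* o m (n ∸ m) ⟩
  o ^ m * o ^ (n ∸ m) ≡⟨ *-comm (o ^ m) _ ⟩
  o ^ (n ∸ m) * o ^ m ∎)
  where open ≡-Reasoning

module _ {p : ℕ} .{{_ : NonZero p}} where

  valuation-^-∣⇔ : ∀ {x e k} → Valuation p x e → p ^ k ∣ x ⇔ k ≤ e
  valuation-^-∣⇔ {e = e} {k} (valuation u refl p∤u) =
    mk⇔ pᵏ∣x⇒k≤e (λ k≤e → ∣-trans (m≤n⇒o^m∣o^n p k≤e) (m∣m*n u))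
    where
    pᵏ∣x⇒k≤e : p ^ k ∣ p ^ e * u → k ≤ e
    pᵏ∣x⇒k≤e pᵏ∣x with k ≤? e
    ... | yes k≤e = k≤e
    ... | no k≰e = contradiction (*-cancelˡ-∣ (p ^ e) {{m^n≢0 p e}} pᵉ*p∣pᵉ*u) p∤u
      where
      pᵉ*p∣pᵉ*u : p ^ e * p ∣ p ^ e * u
      pᵉ*p∣pᵉ*u = subst (_∣ p ^ e * u) (*-comm p (p ^ e)) (∣-trans (m≤n⇒o^m∣o^n p (≰⇒> k≰e)) pᵏ∣x)

  valuation⇒≡⌊/⌋ : ∀ {x e} r z → Valuation p x e →
                   (p ^ r) ^ z ∣ x → ¬ (p ^ r) ^ suc z ∣ x → z ≡⌊ e / r ⌋
  valuation⇒≡⌊/⌋ {x} {e} r z v ∣x ∤x = lower , upper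
    where
    [pʳ]ᶻ≡p^[z*r] : ∀ z → (p ^ r) ^ z ≡ p ^ (z * r)
    [pʳ]ᶻ≡p^[z*r] z = trans (^-*-assoc p r z) (cong (p ^_) (*-comm r z))
    lower : z * r ≤ e
    lower = Equivalence.to (valuation-^-∣⇔ v) (subst (_∣ x) ([pʳ]ᶻ≡p^[z*r] z) ∣x)
    upper : e < suc z * r
    upper = ≰⇒> λ [1+z]r≤e →
      ∤x (subst (_∣ x) (sym ([pʳ]ᶻ≡p^[z*r] (suc z))) (Equivalence.from (valuation-^-∣⇔ v) [1+z]r≤e))

exact⇒valuation : ∀ {b x z} → b ^ z ∣ x → ¬ b ^ suc z ∣ x → Valuation b x z
exact⇒valuation {b} {z = z} (divides u refl) ∤x = valuation u (*-comm u (b ^ z)) b∤u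
  where
  b∤u : ¬ b ∣ u
  b∤u (divides w refl) = ∤x (divides w (begin
    w * b * b ^ z   ≡⟨ *-assoc w b (b ^ z) ⟩
    w * (b * b ^ z) ∎))
    where open ≡-Reasoning

module _ {p : ℕ} (p-prime : Prime p) where

  valuation-* : ∀ {x y e f} → Valuation p x e → Valuation p y f → Valuation p (x * y) (e + f)
  valuation-* {e = e} {f} (valuation u refl p∤u) (valuation w refl p∤w) =
    valuation (u * w) reassociate p∤u*w
    where
    open ≡-Reasoning
    reassociate : p ^ e * u * (p ^ f * w) ≡ p ^ (e + f) * (u * w)
    reassociate = begin
      p ^ e * u * (p ^ f * w)   ≡⟨ interchange (p ^ e) u (p ^ f) w ⟩
      p ^ e * p ^ f * (u * w)   ≡⟨ cong (_* (u * w)) (sym (^-distribˡ-+-* p e f)) ⟩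
      p ^ (e + f) * (u * w)     ∎
      where
      interchange : ∀ a b c d → a * b * (c * d) ≡ a * c * (b * d)
      interchange = solve-∀
    p∤u*w : ¬ p ∣ u * w
    p∤u*w p∣u*w = [ p∤u , p∤w ]′ (euclidsLemma u w p-prime p∣u*w)

  ¬∣⇒gcd≡1 : ∀ {a} → ¬ p ∣ a → gcd p a ≡ 1
  ¬∣⇒gcd≡1 {a} p∤a = coprime⇒gcd≡1 coprime
    where
    coprime : Coprime p a
    coprime (d∣p , d∣a) with prime⇒irreducible p-prime d∣p
    ... | inj₁ d≡1 = d≡1
    ... | inj₂ refl = contradiction d∣a p∤a

module _ {p : ℕ} .{{_ : NonTrivial p}} where

  gcd≡1⇒¬∣ : ∀ {a} → gcd p a ≡ 1 → ¬ p ∣ a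
  gcd≡1⇒¬∣ gcd≡1 p∣a = nonTrivial⇒≢1 (gcd≡1⇒coprime gcd≡1 (∣-refl , p∣a))

  valuation-exists : ∀ x .{{_ : NonZero x}} → ∃[ e ] Valuation p x e
  valuation-exists = <-rec (λ x → .{{NonZero x}} → ∃[ e ] Valuation p x e) step
    where
    step : ∀ x → (∀ {y} → y < x → .{{NonZero y}} → ∃[ e ] Valuation p y e) →
           .{{NonZero x}} → ∃[ e ] Valuation p x e
    step x rec with p ∣? x
    ... | no p∤x = 0 , valuation x (sym (*-identityˡ x)) p∤x
    ... | yes p∣x@(divides q refl) with rec (quotient-< p∣x) {{quotient≢0 p∣x}}
    ...   | e , valuation u refl p∤u = suc e , valuation u (rotate (p ^ e) u p) p∤u
      where
      rotate : ∀ a b c → a * b * c ≡ c * a * b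
      rotate = solve-∀

proposition5 : (p r n : ℕ) → Prime p → 2 ≤ r →
    (zp α β : ℕ) → TrailingZeros p n zp → zp ≡ α * r + β → β < r →
    (z₀ z₁ : ℕ) → TrailingZeros (p ^ r) n z₀ → TrailingZeros (p ^ r) (suc n) z₁ →
    (z₁ ≡ z₀ ⇔ (∃[ m ] ∃[ a ] (suc n ≡ p ^ m * a × gcd p a ≡ 1 × m + β < r)))
proposition5 p r n p-prime _ _ α β tzp refl β<r z₀ z₁ tz₀ tz₁ = mk⇔ to from
  where
  instance
    _ : NonZero p
    _ = prime⇒nonZero p-prime
    _ : NonTrivial p
    _ = prime⇒nonTrivial p-prime

  v[n!] : Valuation p (n !) (α * r + β)
  v[n!] = uncurry exact⇒valuation tzp

  z₀≡α : z₀ ≡ α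
  z₀≡α = ≡⌊⌋-unique (uncurry (valuation⇒≡⌊/⌋ r z₀ v[n!]) tz₀)
                    (Equivalence.from (≡⌊q*r+k/r⌋⇔k<r r α β) β<r)

  z₁≡z₀⇔ : ∀ {m} → Valuation p (suc n) m → z₁ ≡ z₀ ⇔ m + β < r
  z₁≡z₀⇔ {m} v[n+1] = ⇔.trans (≡⌊⌋⇒[≡⇔≡⌊⌋] z₁⌊⌋)
    (subst (λ q → q ≡⌊ α * r + (m + β) / r ⌋ ⇔ m + β < r) (sym z₀≡α) (≡⌊q*r+k/r⌋⇔k<r r α (m + β)))
    where
    rearrange : ∀ m x β → m + (x + β) ≡ x + (m + β)
    rearrange = solve-∀
    z₁⌊⌋ : z₁ ≡⌊ α * r + (m + β) / r ⌋
    z₁⌊⌋ = subst (z₁ ≡⌊_/ r ⌋) (rearrange m (α * r) β)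
      (uncurry (valuation⇒≡⌊/⌋ r z₁ (valuation-* p-prime v[n+1] v[n!])) tz₁)

  to : z₁ ≡ z₀ → ∃[ m ] ∃[ a ] (suc n ≡ p ^ m * a × gcd p a ≡ 1 × m + β < r)
  to z₁≡z₀ with valuation-exists (suc n)
  ... | m , v@(valuation a n+1≡pᵐa p∤a) =
    m , a , n+1≡pᵐa , ¬∣⇒gcd≡1 p-prime p∤a , Equivalence.to (z₁≡z₀⇔ v) z₁≡z₀

  from : ∃[ m ] ∃[ a ] (suc n ≡ p ^ m * a × gcd p a ≡ 1 × m + β < r) → z₁ ≡ z₀
  from (m , a , n+1≡pᵐa , gcd≡1 , m+β<r) =
    Equivalence.from (z₁≡z₀⇔ (valuation a n+1≡pᵐa (gcd≡1⇒¬∣ gcd≡1))) m+β<r
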